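{- Let $G=(V,E)$ be a finite simple undirected graph, let $\mathcal{G}=(\mathcal{V},\mathcal{E})$ be a lossless summary of $G$, and let $u,v\in V$ satisfy $S(u)\neq S(v)$, where $S(x)$ denotes the supernode containing $x$. Then the shortest-path distance between $u$ and $v$ in $G$ equals the shortest-path distance between $S(u)$ and $S(v)$ in the graph with vertex set $\mathcal{V}$ and edge set $\{\{X,Y\}\in\mathcal{E}: X\neq Y\}$ (both distances being $\infty$ when no path exists).
   Context: A summary of $G$ is a pair $(\mathcal{V},\mathcal{E})$ where $\mathcal{V}$ is a partition of $V$ into nonempty sets (supernodes) and $\mathcal{E}$ a set of unordered pairs $\{S_i,S_j\}$ of supernodes ($i=j$ allowed, a self-loop), called superedges. Its reconstruction is the simple graph on $V$ containing, for each superedge $\{S_i,S_j\}$ with $i\neq j$, all pairs $\{x,y\}$ with $x\in S_i, y\in S_j$, and for each self-loop $\{S_i,S_i\}$, all pairs of distinct nodes of $S_i$. The summary is lossless if its reconstruction equals $G$. -}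

module Defs where

open import Data.Nat using (ℕ; zero; suc; _<_)
open import Data.Fin using (Fin)
open import Data.Maybe using (Maybe; just; nothing)
open import Data.Product using (Σ; _×_; ∃)
open import Relation.Nullary using (¬_)
open import Relation.Binary.PropositionalEquality using (_≡_; _≢_)

record Graph (n : ℕ) : Set₁ where
  field
    Adj   : Fin n → Fin n → Set
    sym   : ∀ {x y} → Adj x y → Adj y x
    irref : ∀ {x} → ¬ Adj x x
open Graph public

-- The partition V = S_0 ∪ … ∪ S_{k-1} into nonempty sets is given by the
-- map  node : Fin n → Fin k  (node x = index of the supernode S(x)),
-- required surjective (every supernode nonempty).
-- The superedges form a set of unordered pairs {S_i,S_j} (i = j allowed),
-- encoded as a symmetric relation SE on Fin k.
record Summary (n k : ℕ) : Set₁ where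
  field
    node     : Fin n → Fin k
    nonempty : ∀ (i : Fin k) → ∃ λ x → node x ≡ i
    SE       : Fin k → Fin k → Set
    SE-sym   : ∀ {i j} → SE i j → SE j i
open Summary public

-- Reconstruction of a summary: x,y distinct and {S(x),S(y)} a superedge
-- (this covers both the case S(x) ≠ S(y) and the self-loop case S(x) = S(y)).
Recon : ∀ {n k} → Summary n k → Fin n → Fin n → Set
Recon s x y = (x ≢ y) × SE s (node s x) (node s y)

Lossless : ∀ {n k} → Graph n → Summary n k → Set
Lossless G s = ∀ x y → (Adj G x y → Recon s x y) × (Recon s x y → Adj G x y)

SuperAdj : ∀ {n k} → Summary n k → Fin k → Fin k → Set
SuperAdj s X Y = SE s X Y × (X ≢ Y)

data Walk {m : ℕ} (R : Fin m → Fin m → Set) : Fin m → Fin m → ℕ → Set where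
  [] : ∀ {x} → Walk R x x zero
  _∷_ : ∀ {x y z d} → R x y → Walk R y z d → Walk R x z (suc d)

-- Shortest-path distance, with nothing = ∞.
-- IsDist R x y δ : δ is the shortest-path distance from x to y.
IsDist : ∀ {m} → (Fin m → Fin m → Set) → Fin m → Fin m → Maybe ℕ → Set
IsDist R x y (just d) = Walk R x y d × (∀ e → e < d → ¬ Walk R x y e)
IsDist R x y nothing  = ∀ e → ¬ Walk R x y e

-- A walk in G maps to a walk between the supernodes that is no longer: steps
-- inside one supernode are dropped, and by losslessness every other edge lies
-- on a superedge. Conversely, since supernodes are nonempty and distinct
-- supernodes joined by a superedge are completely joined in G, a walk of
-- positive length in the supernode graph lifts, through arbitrary
-- representatives, to a walk of the same length in G. Walk maps of this kind
-- in both directions force the two distances to coincide.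
module Submission where

open import Defs
open import Data.Nat using (ℕ; suc; _≤_; _<_; z≤n; s≤s)
open import Data.Nat.Properties using (≤-refl; ≤-trans; <-≤-trans; n≤1+n; ≤∧≮⇒≡)
open import Data.Fin using (Fin)
open import Data.Fin.Properties using (_≟_)
open import Data.Maybe using (Maybe; just; nothing)
open import Data.Product using (_×_; _,_; proj₁; proj₂; ∃)
open import Relation.Nullary using (¬_; yes; no; contradiction)
open import Relation.Binary.PropositionalEquality using (_≡_; _≢_; refl; cong; subst) renaming (sym to ≡-sym)

ShortensWalks : ∀ {m m′} → (Fin m → Fin m → Set) → Fin m → Fin m →
                (Fin m′ → Fin m′ → Set) → Fin m′ → Fin m′ → Set
ShortensWalks R x y R′ x′ y′ = ∀ {d} → Walk R x y d → ∃ λ e → e ≤ d × Walk R′ x′ y′ e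

isDist-transfer : ∀ {m m′} {R : Fin m → Fin m → Set} {R′ : Fin m′ → Fin m′ → Set}
                    {x y : Fin m} {x′ y′ : Fin m′} →
                  ShortensWalks R x y R′ x′ y′ → ShortensWalks R′ x′ y′ R x y →
                  ∀ δ → IsDist R x y δ → IsDist R′ x′ y′ δ
isDist-transfer to from nothing noWalk _ w′ with from w′
... | e , _ , w = noWalk e w
isDist-transfer {R′ = R′} {x′ = x′} {y′} to from (just d) (w , minimal) with to w
... | e , e≤d , w′ = subst (Walk R′ x′ y′) (≤∧≮⇒≡ e≤d (λ e<d → minimal′ e e<d w′)) w′ , minimal′
  where
  minimal′ : ∀ e′ → e′ < d → ¬ Walk R′ x′ y′ e′
  minimal′ e′ e′<d w″ with from w″
  ... | e″ , e″≤e′ , w‴ = minimal e″ (<-≤-trans (s≤s e″≤e′) e′<d) w‴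

module _ {n k} (G : Graph n) (s : Summary n k) (lossless : Lossless G s) where

  adj⇒superedge : ∀ {x y} → Adj G x y → SE s (node s x) (node s y)
  adj⇒superedge {x} {y} a = proj₂ (proj₁ (lossless x y) a)

  superAdj⇒adj : ∀ {x y} → SuperAdj s (node s x) (node s y) → Adj G x y
  superAdj⇒adj {x} {y} (se , X≢Y) = proj₂ (lossless x y) ((λ x≡y → X≢Y (cong (node s) x≡y)) , se)

  walk⇒superWalk : ∀ {x y} → ShortensWalks (Adj G) x y (SuperAdj s) (node s x) (node s y)
  walk⇒superWalk [] = _ , z≤n , []
  walk⇒superWalk {x} {y} (_∷_ {y = r} a w) with walk⇒superWalk w | node s x ≟ node s r
  ... | e , e≤d , w′ | yes X≡R =
    e , ≤-trans e≤d (n≤1+n _) , subst (λ X → Walk (SuperAdj s) X (node s y) e) (≡-sym X≡R) w′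
  ... | e , e≤d , w′ | no X≢R = suc e , s≤s e≤d , (adj⇒superedge a , X≢R) ∷ w′

  superWalk⁺⇒walk : ∀ {X Z d} x y → node s x ≡ X → node s y ≡ Z →
                    Walk (SuperAdj s) X Z (suc d) → Walk (Adj G) x y (suc d)
  superWalk⁺⇒walk x y refl refl (a ∷ []) = superAdj⇒adj a ∷ []
  superWalk⁺⇒walk x y refl y∈Z (_∷_ {y = Y} a w@(_ ∷ _)) with nonempty s Y
  ... | r , refl = superAdj⇒adj a ∷ superWalk⁺⇒walk r y refl y∈Z w

  superWalk⇒walk : ∀ {X Z x y} → node s x ≡ X → node s y ≡ Z → X ≢ Z →
                   ShortensWalks (SuperAdj s) X Z (Adj G) x y
  superWalk⇒walk _   _   X≢Z []         = contradiction refl X≢Z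
  superWalk⇒walk x∈X y∈Z _   w@(_ ∷ _) = _ , ≤-refl , superWalk⁺⇒walk _ _ x∈X y∈Z w

theorem3p7 : ∀ {n k} (G : Graph n) (s : Summary n k) → Lossless G s →
    ∀ (u v : Fin n) → node s u ≢ node s v →
    ∀ (δ : Maybe ℕ) →
      (IsDist (Adj G) u v δ → IsDist (SuperAdj s) (node s u) (node s v) δ) ×
      (IsDist (SuperAdj s) (node s u) (node s v) δ → IsDist (Adj G) u v δ)
theorem3p7 G s lossless u v U≢V δ =
  isDist-transfer (walk⇒superWalk G s lossless) (superWalk⇒walk G s lossless refl refl U≢V) δ ,
  isDist-transfer (superWalk⇒walk G s lossless refl refl U≢V) (walk⇒superWalk G s lossless) δ
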